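{- Let $G=(V,A)$ be a directed acyclic graph, let $L\subseteq V$ be a set of ranked vertices and $r:V\to\mathbb{Z}^+\cup\{\infty\}$ a function that is injective on $L$ and equals $\infty$ on $V\setminus L$. For every $v\in V$: (i) for all $1<i\le k(v)$ we have $r(\ell_{i-1}(v))<r(\ell_i(v))$; (ii) if $r(v)<\infty$, then $v\in A_1(v)\cap A_2(v)\cap\cdots\cap A_{k(v)}(v)$ and $\ell_{k(v)}(v)=v$.
   Context: For a vertex $v$, $P(v)$ is the set of vertices $u$ such that there is a directed path from $u$ to $v$, and $S(v)$ is the set of vertices $u$ such that there is a directed path from $v$ to $u$; by convention $v\in P(v)\cap S(v)$. For vertices $u,v$ let $D(u,v)=S(u)\cap P(v)$. Define $A_1(v)=P(v)\cap L$. Inductively, for $i\ge 1$, if $A_i(v)\neq\emptyset$ let $\ell_i(v)$ be the vertex of $A_i(v)$ of minimum rank $r$, and let $A_{i+1}(v)=\big(D(\ell_i(v),v)\setminus\{\ell_i(v)\}\big)\cap L$. Let $k(v)=0$ if $A_1(v)=\emptyset$, and otherwise let $k(v)$ be the largest $i$ with $A_i(v)\neq\emptyset$. The label of $v$ is the sequence $\ell(v)=(\ell_1(v),\ldots,\ell_{k(v)}(v))$. -}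

module Defs where

open import Data.Nat using (ℕ; zero; suc; _≤_; _<_)
open import Data.Fin using (Fin; zero; suc)
open import Data.Bool using (Bool; T)
open import Data.Maybe using (Maybe; just; nothing)
open import Data.List using (List; []; _∷_; length)
open import Data.Unit using (⊤)
open import Data.Empty using (⊥)
open import Data.Product using (_×_)
open import Relation.Nullary using (¬_)
open import Relation.Binary.PropositionalEquality using (_≡_; _≢_)
open import Relation.Binary.Construct.Closure.ReflexiveTransitive using (Star)

-- Extended positive integers ℤ⁺ ∪ {∞}: `nothing` plays the role of ∞.
ℕ∞ : Set
ℕ∞ = Maybe ℕ

_≤∞_ : ℕ∞ → ℕ∞ → Set
just a  ≤∞ just b  = a ≤ b
_       ≤∞ nothing = ⊤
nothing ≤∞ just _  = ⊥

_<∞_ : ℕ∞ → ℕ∞ → Set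
just a  <∞ just b  = a < b
just _  <∞ nothing = ⊤
nothing <∞ _       = ⊥

Arc : ∀ {n} → (Fin n → Fin n → Bool) → Fin n → Fin n → Set
Arc adj u w = T (adj u w)

Reach : ∀ {n} → (Fin n → Fin n → Bool) → Fin n → Fin n → Set
Reach adj = Star (Arc adj)

Acyclic : ∀ {n} → (Fin n → Fin n → Bool) → Set
Acyclic adj = ∀ u w → Arc adj u w → ¬ Reach adj w u

module Labels {n : ℕ} (adj : Fin n → Fin n → Bool) (L : Fin n → Bool) (r : Fin n → ℕ∞) where

  VSet : Set₁
  VSet = Fin n → Set

  P : Fin n → VSet
  P v u = Reach adj u v

  S : Fin n → VSet
  S v u = Reach adj v u

  D : Fin n → Fin n → VSet
  D u v w = S u w × P v w

  A₁ : Fin n → VSet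
  A₁ v u = P v u × T (L u)

  -- A_{i+1}(v) = (D(ℓ_i(v), v) ∖ {ℓ_i(v)}) ∩ L, as a function of ℓ_i(v)
  Anext : Fin n → Fin n → VSet
  Anext v ℓ u = (D ℓ v u × u ≢ ℓ) × T (L u)

  IsMinRank : VSet → Fin n → Set
  IsMinRank X x = X x × (∀ y → X y → r x ≤∞ r y)

  data Chain (v : Fin n) : VSet → List (Fin n) → Set₁ where
    done : ∀ {X} → (∀ u → ¬ X u) → Chain v X []
    step : ∀ {X x xs} → IsMinRank X x → Chain v (Anext v x) xs → Chain v X (x ∷ xs)

  -- IsLabel v ℓs : ℓs = (ℓ₁(v), …, ℓ_{k(v)}(v)) is the label of v (k(v) = length ℓs)
  IsLabel : Fin n → List (Fin n) → Set₁
  IsLabel v = Chain v (A₁ v)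

  AatFrom : Fin n → VSet → (ℓs : List (Fin n)) → Fin (length ℓs) → VSet
  AatFrom v X (x ∷ xs) zero    = X
  AatFrom v X (x ∷ xs) (suc i) = AatFrom v (Anext v x) xs i

  -- Aat v ℓs i = A_{i+1}(v) (0-based index i : Fin k(v))
  Aat : Fin n → (ℓs : List (Fin n)) → Fin (length ℓs) → VSet
  Aat v = AatFrom v (A₁ v)

-- Every set A_{i+1}(v) consists of ranked vertices strictly between ℓ_i(v) and v, so
-- it is contained in A_i(v) and misses ℓ_i(v). Hence ℓ_{i+1}(v) competes in the minimum
-- defining ℓ_i(v), giving r(ℓ_i) ≤ r(ℓ_{i+1}), and injectivity of r on L makes this
-- strict. The sets shrink strictly, so the process terminates, and reachability is
-- decidable because paths in a DAG on n vertices have length below n. If v is ranked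
-- it lies in A_1(v) and stays in every A_i(v) until it is itself chosen, after which
-- A_{i+1}(v) ⊆ D(v,v) ∖ {v} = ∅.
module Submission where

open import Defs
open import Data.Nat using (ℕ; suc; _≤_)
open import Data.Fin using (Fin; toℕ)
open import Data.Bool using (Bool; T)
open import Data.Maybe using (just; nothing)
open import Data.List using (List; length; lookup)
open import Data.Product using (Σ; ∃; _×_)
open import Relation.Nullary using (¬_)
open import Relation.Binary.PropositionalEquality using (_≡_)

open import Level using (0ℓ)
open import Data.Nat as ℕ using (zero; s≤s)
import Data.Nat.Properties as ℕ
open import Data.Nat.Induction using (<-wellFounded)
open import Data.Fin as Fin using (zero; suc; _≟_)
open import Data.Fin.Properties using (any?; injective⇒≤; <-cmp)
open import Data.Fin.Subset as Subset using (Subset; ∣_∣)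
open import Data.Fin.Subset.Properties using (p⊂q⇒∣p∣<∣q∣)
open import Data.Vec using (tabulate)
open import Data.Vec.Properties using (lookup∘tabulate; []=⇒lookup; lookup⇒[]=)
open import Data.Bool using (T?)
open import Data.List using ([]; _∷_)
open import Data.Product using (_,_; proj₁; proj₂)
open import Data.Sum using (_⊎_; inj₁; inj₂)
open import Data.Unit using (tt)
open import Function using (_∘_)
open import Induction.WellFounded using (Acc; acc)
open import Relation.Nullary using (Dec; yes; no; does; contradiction)
open import Relation.Nullary.Decidable using (_×-dec_; ¬?; map′; dec-true)
open import Relation.Unary using (Pred; Decidable; Empty; _⊆_)
open import Relation.Binary using (Rel; Reflexive; Transitive; Total; tri<; tri≈; tri>)
open import Relation.Binary.PropositionalEquality using (_≢_; refl; sym; trans; cong; subst)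
open import Relation.Binary.Construct.Closure.ReflexiveTransitive using (ε; _◅_; _◅◅_)

≤∞-refl : Reflexive _≤∞_
≤∞-refl {just a}  = ℕ.≤-refl
≤∞-refl {nothing} = tt

≤∞-trans : Transitive _≤∞_
≤∞-trans {just a}  {just b}  {just c}  p q = ℕ.≤-trans p q
≤∞-trans {just a}  {just b}  {nothing} p q = tt
≤∞-trans {just a}  {nothing} {nothing} p q = tt
≤∞-trans {nothing} {nothing} {nothing} p q = tt

≤∞-total : Total _≤∞_
≤∞-total (just a) (just b)  = ℕ.≤-total a b
≤∞-total (just a) nothing   = inj₁ tt
≤∞-total nothing  (just b)  = inj₂ tt
≤∞-total nothing  nothing   = inj₁ tt

≤∞∧≢⇒<∞ : ∀ {a b} → a ≤∞ b → a ≢ b → a <∞ b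
≤∞∧≢⇒<∞ {just a}  {just b}  a≤b a≢b = ℕ.≤∧≢⇒< a≤b (a≢b ∘ cong just)
≤∞∧≢⇒<∞ {just a}  {nothing} a≤b a≢b = tt
≤∞∧≢⇒<∞ {nothing} {nothing} a≤b a≢b = contradiction refl a≢b

module _ {a ℓ} {A : Set a} {_≼_ : Rel A ℓ}
         (≼-refl : Reflexive _≼_) (≼-trans : Transitive _≼_) (≼-total : Total _≼_) where

  argmin : ∀ {m} {P : Pred (Fin m) 0ℓ} → Decidable P → (key : Fin m → A)
         → Empty P ⊎ ∃ λ x → P x × (∀ y → P y → key x ≼ key y)
  argmin {zero} P? key = inj₁ λ ()
  argmin {suc m} P? key with P? zero | argmin (P? ∘ suc) (key ∘ suc)
  ... | no ¬p₀ | inj₁ empty = inj₁ λ { zero → ¬p₀ ; (suc y) → empty y }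
  ... | no ¬p₀ | inj₂ (x , px , min) =
    inj₂ (suc x , px , λ { zero p₀ → contradiction p₀ ¬p₀ ; (suc y) → min y })
  ... | yes p₀ | inj₁ empty =
    inj₂ (zero , p₀ , λ { zero _ → ≼-refl ; (suc y) p → contradiction p (empty y) })
  ... | yes p₀ | inj₂ (x , px , min) with ≼-total (key zero) (key (suc x))
  ...   | inj₁ k₀≼kx =
    inj₂ (zero , p₀ , λ { zero _ → ≼-refl ; (suc y) p → ≼-trans k₀≼kx (min y p) })
  ...   | inj₂ kx≼k₀ = inj₂ (suc x , px , λ { zero _ → kx≼k₀ ; (suc y) → min y })

module _ {m} {P : Pred (Fin m) 0ℓ} (P? : Decidable P) where

  toSubset : Subset m
  toSubset = tabulate (does ∘ P?)

  ∈-toSubset⁺ : ∀ {x} → P x → x Subset.∈ toSubset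
  ∈-toSubset⁺ {x} px = lookup⇒[]= x toSubset (trans (lookup∘tabulate _ x) (dec-true (P? x) px))

  ∈-toSubset⁻ : ∀ {x} → x Subset.∈ toSubset → P x
  ∈-toSubset⁻ {x} x∈ with P? x | trans (sym (lookup∘tabulate (does ∘ P?) x)) ([]=⇒lookup x∈)
  ... | yes px | _ = px

toSubset-⊂ : ∀ {m} {P Q : Pred (Fin m) 0ℓ} (P? : Decidable P) (Q? : Decidable Q)
           → P ⊆ Q → ∀ {x} → Q x → ¬ P x → toSubset P? Subset.⊂ toSubset Q?
toSubset-⊂ P? Q? P⊆Q {x} qx ¬px =
  ∈-toSubset⁺ Q? ∘ P⊆Q ∘ ∈-toSubset⁻ P? , x , ∈-toSubset⁺ Q? qx , ¬px ∘ ∈-toSubset⁻ P?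

module DAG {n} (adj : Fin n → Fin n → Bool) (acyclic : Acyclic adj) where

  Reach-antisym : ∀ {x y} → Reach adj x y → Reach adj y x → x ≡ y
  Reach-antisym ε          _   = refl
  Reach-antisym (xz ◅ z⇝y) y⇝x = contradiction (z⇝y ◅◅ y⇝x) (acyclic _ _ xz)

  data ReachWithin : ℕ → Fin n → Fin n → Set where
    here  : ∀ {k u} → ReachWithin k u u
    there : ∀ {k u z w} → Arc adj u z → ReachWithin k z w → ReachWithin (suc k) u w

  ReachWithin? : ∀ k u w → Dec (ReachWithin k u w)
  ReachWithin? k u w with u ≟ w
  ReachWithin? k       u .u | yes refl = yes here
  ReachWithin? zero    u w  | no u≢w = no λ { here → u≢w refl }
  ReachWithin? (suc k) u w  | no u≢w =
    map′ (λ (z , uz , z⇝w) → there uz z⇝w)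
         (λ { here → contradiction refl u≢w ; (there uz z⇝w) → _ , uz , z⇝w })
         (any? λ z → T? (adj u z) ×-dec ReachWithin? k z w)

  ReachWithin⇒Reach : ∀ {k u w} → ReachWithin k u w → Reach adj u w
  ReachWithin⇒Reach here          = ε
  ReachWithin⇒Reach (there uz z⇝w) = uz ◅ ReachWithin⇒Reach z⇝w

  ReachWithin-mono : ∀ {k k′ u w} → k ≤ k′ → ReachWithin k u w → ReachWithin k′ u w
  ReachWithin-mono _         here          = here
  ReachWithin-mono (s≤s k≤k′) (there uz z⇝w) = there uz (ReachWithin-mono k≤k′ z⇝w)

  pathLength : ∀ {u w} → Reach adj u w → ℕ
  pathLength ε        = 0
  pathLength (_ ◅ p) = suc (pathLength p)

  Reach⇒ReachWithin-pathLength : ∀ {u w} (p : Reach adj u w) → ReachWithin (pathLength p) u w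
  Reach⇒ReachWithin-pathLength ε        = here
  Reach⇒ReachWithin-pathLength (uz ◅ p) = there uz (Reach⇒ReachWithin-pathLength p)

  vertexAt : ∀ {u w} (p : Reach adj u w) → Fin (suc (pathLength p)) → Fin n
  vertexAt {u} p       zero    = u
  vertexAt (_ ◅ p) (suc i) = vertexAt p i

  arc-towards-later-vertex : ∀ {u w} (p : Reach adj u w) {i j} → i Fin.< j
                           → ∃ λ z → Arc adj (vertexAt p i) z × Reach adj z (vertexAt p j)
  arc-towards-later-vertex (uz ◅ p) {zero} {suc j} _ = _ , uz , prefix p j
    where
      prefix : ∀ {u w} (p : Reach adj u w) j → Reach adj u (vertexAt p j)
      prefix p       zero    = ε
      prefix (uz ◅ p) (suc j) = uz ◅ prefix p j
  arc-towards-later-vertex (_ ◅ p) {suc i} {suc j} (s≤s i<j) = arc-towards-later-vertex p i<j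

  vertexAt-injective : ∀ {u w} (p : Reach adj u w) {i j} → vertexAt p i ≡ vertexAt p j → i ≡ j
  vertexAt-injective p {i} {j} eq with <-cmp i j
  ... | tri≈ _ i≡j _ = i≡j
  ... | tri< i<j _ _ with z , a , z⇝ ← arc-towards-later-vertex p i<j =
    contradiction (subst (Reach adj z) (sym eq) z⇝) (acyclic _ _ a)
  ... | tri> _ _ j<i with z , a , z⇝ ← arc-towards-later-vertex p j<i =
    contradiction (subst (Reach adj z) eq z⇝) (acyclic _ _ a)

  pathLength<n : ∀ {u w} (p : Reach adj u w) → pathLength p ℕ.< n
  pathLength<n p = injective⇒≤ (vertexAt-injective p)

  Reach? : ∀ u w → Dec (Reach adj u w)
  Reach? u w = map′ ReachWithin⇒Reach reachWithin-n (ReachWithin? n u w)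
    where
      reachWithin-n : Reach adj u w → ReachWithin n u w
      reachWithin-n p = ReachWithin-mono (ℕ.<⇒≤ (pathLength<n p)) (Reach⇒ReachWithin-pathLength p)

module LabelProperties {n} (adj : Fin n → Fin n → Bool) (L : Fin n → Bool) (r : Fin n → ℕ∞)
  (acyclic : Acyclic adj) (r-injective-on-L : ∀ u v → T (L u) → T (L v) → r u ≡ r v → u ≡ v)
  where

  open Labels adj L r
  open DAG adj acyclic

  A₁? : ∀ v → Decidable (A₁ v)
  A₁? v u = Reach? u v ×-dec T? (L u)

  Anext? : ∀ v ℓ → Decidable (Anext v ℓ)
  Anext? v ℓ u = ((Reach? ℓ u ×-dec Reach? u v) ×-dec ¬? (u ≟ ℓ)) ×-dec T? (L u)

  Anext-irreflexive : ∀ v ℓ → ¬ Anext v ℓ ℓ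
  Anext-irreflexive v ℓ ((_ , ℓ≢ℓ) , _) = ℓ≢ℓ refl

  Anext-self-empty : ∀ v → Empty (Anext v v)
  Anext-self-empty v u (((v⇝u , u⇝v) , u≢v) , _) = u≢v (sym (Reach-antisym v⇝u u⇝v))

  NextClosed : Fin n → VSet → Set
  NextClosed v X = ∀ {y} → X y → Anext v y ⊆ X

  A₁-nextClosed : ∀ v → NextClosed v (A₁ v)
  A₁-nextClosed v _ (((_ , u⇝v) , _) , Lu) = u⇝v , Lu

  Anext-nextClosed : ∀ v ℓ → NextClosed v (Anext v ℓ)
  Anext-nextClosed v ℓ (((ℓ⇝y , _) , y≢ℓ) , _) (((y⇝u , u⇝v) , _) , Lu) =
    ((ℓ⇝y ◅◅ y⇝u , u⇝v) , λ { refl → y≢ℓ (sym (Reach-antisym ℓ⇝y y⇝u)) }) , Lu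

  chain-from : ∀ v X (X? : Decidable X) → NextClosed v X → Acc ℕ._<_ ∣ toSubset X? ∣
             → ∃ (Chain v X)
  chain-from v X X? closed (acc rec) with argmin ≤∞-refl ≤∞-trans ≤∞-total X? r
  ... | inj₁ empty = [] , done empty
  ... | inj₂ (x , min@(x∈X , _))
    with xs , chain ← chain-from v (Anext v x) (Anext? v x) (Anext-nextClosed v x)
           (rec (p⊂q⇒∣p∣<∣q∣ (toSubset-⊂ (Anext? v x) X? (closed x∈X) x∈X (Anext-irreflexive v x))))
    = x ∷ xs , step min chain

  label-exists : ∀ v → ∃ (IsLabel v)
  label-exists v = chain-from v (A₁ v) (A₁? v) (A₁-nextClosed v) (<-wellFounded _)

  next-rank< : ∀ {v X x y} → NextClosed v X → X ⊆ (λ u → T (L u))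
             → IsMinRank X x → IsMinRank (Anext v x) y → r x <∞ r y
  next-rank< {x = x} {y} closed X⊆L (x∈X , min) (y∈next@((_ , y≢x) , Ly) , _) =
    ≤∞∧≢⇒<∞ (min y (closed x∈X y∈next)) (y≢x ∘ sym ∘ r-injective-on-L x y (X⊆L x∈X) Ly)

  chain-rank-increasing : ∀ {v X ℓs} → NextClosed v X → X ⊆ (λ u → T (L u)) → Chain v X ℓs
                        → ∀ (i j : Fin (length ℓs)) → toℕ j ≡ suc (toℕ i)
                        → r (lookup ℓs i) <∞ r (lookup ℓs j)
  chain-rank-increasing closed X⊆L (step min (step min′ _)) zero (suc zero) _ =
    next-rank< closed X⊆L min min′
  chain-rank-increasing {v} {ℓs = x ∷ _} _ _ (step _ chain) (suc i) (suc j) j≡1+i =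
    chain-rank-increasing (Anext-nextClosed v x) proj₂ chain i j (ℕ.suc-injective j≡1+i)

  target-in-next : ∀ {v x} {X : VSet} → X ⊆ P v → T (L v) → X x → x ≢ v → Anext v x v
  target-in-next X⊆Pv Lv x∈X x≢v = ((X⊆Pv x∈X , ε) , x≢v ∘ sym) , Lv

  chain-from-empty : ∀ {v X ℓs} → Empty X → Chain v X ℓs → ℓs ≡ []
  chain-from-empty empty (done _)        = refl
  chain-from-empty empty (step (x∈X , _) _) = contradiction x∈X (empty _)

  target-in-every-A : ∀ {v X ℓs} → X v → X ⊆ P v → T (L v) → Chain v X ℓs
                    → ∀ i → AatFrom v X ℓs i v
  target-in-every-A v∈X _ _ (step _ _) zero = v∈X
  target-in-every-A {v} v∈X X⊆Pv Lv (step {x = x} (x∈X , _) chain) (suc i) with x ≟ v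
  ... | yes refl with refl ← chain-from-empty (Anext-self-empty v) chain = contradiction i λ ()
  ... | no x≢v =
    target-in-every-A (target-in-next X⊆Pv Lv x∈X x≢v) (proj₂ ∘ proj₁ ∘ proj₁) Lv chain i

  chain-ends-at-target : ∀ {v X ℓs} → X v → X ⊆ P v → T (L v) → Chain v X ℓs
                       → Σ (Fin (length ℓs)) λ i → suc (toℕ i) ≡ length ℓs × lookup ℓs i ≡ v
  chain-ends-at-target v∈X _ _ (done empty) = contradiction v∈X (empty _)
  chain-ends-at-target {v} v∈X X⊆Pv Lv (step {x = x} (x∈X , _) chain) with x ≟ v
  ... | yes refl with refl ← chain-from-empty (Anext-self-empty v) chain = zero , refl , refl
  ... | no x≢v
    with i , last , ℓᵢ≡v ← chain-ends-at-target (target-in-next X⊆Pv Lv x∈X x≢v)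
                                                (proj₂ ∘ proj₁ ∘ proj₁) Lv chain =
    suc i , cong suc last , ℓᵢ≡v

proposition1 : ∀ {n : ℕ} (adj : Fin n → Fin n → Bool) (L : Fin n → Bool) (r : Fin n → ℕ∞)
    → Acyclic adj
    → (∀ k {v} → r v ≡ just k → 1 ≤ k)
    → (∀ u v → T (L u) → T (L v) → r u ≡ r v → u ≡ v)
    → (∀ v → ¬ T (L v) → r v ≡ nothing)
    → ∀ (v : Fin n)
    → (Σ (List (Fin n)) λ ℓs → Labels.IsLabel adj L r v ℓs)
      × (∀ (ℓs : List (Fin n)) → Labels.IsLabel adj L r v ℓs
          → (∀ (i j : Fin (length ℓs)) → toℕ j ≡ suc (toℕ i)
               → r (lookup ℓs i) <∞ r (lookup ℓs j))
          × ((∃ λ k → r v ≡ just k)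
               → (∀ (i : Fin (length ℓs)) → Labels.Aat adj L r v ℓs i v)
                 × (Σ (Fin (length ℓs)) λ i → suc (toℕ i) ≡ length ℓs × lookup ℓs i ≡ v)))
proposition1 adj L r acyclic _ r-injective-on-L unranked v =
  label-exists v ,
  λ ℓs label →
    chain-rank-increasing (A₁-nextClosed v) proj₂ label ,
    λ (k , rv≡k) → let v∈A₁ = ε , ranked-in-L rv≡k in
      target-in-every-A v∈A₁ proj₁ (proj₂ v∈A₁) label ,
      chain-ends-at-target v∈A₁ proj₁ (proj₂ v∈A₁) label
  where
    open LabelProperties adj L r acyclic r-injective-on-L

    ranked-in-L : ∀ {k} → r v ≡ just k → T (L v)
    ranked-in-L rv≡k with T? (L v)
    ... | yes v∈L = v∈L
    ... | no v∉L with () ← trans (sym rv≡k) (unranked v v∉L)
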